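{- For every duplicative forest $\mathfrak{f}$, the poset $\mathcal{D}^*(\mathfrak{f})$ is a lattice whose meet and join are given by the operations $\wedge$ and $\vee$: for all $\mathfrak{g},\mathfrak{h}\in\mathcal{D}^*(\mathfrak{f})$, $\mathfrak{g}\wedge\mathfrak{h}$ and $\mathfrak{g}\vee\mathfrak{h}$ are defined and are respectively the greatest lower bound and least upper bound of $\mathfrak{g}$ and $\mathfrak{h}$ in $\mathcal{D}^*(\mathfrak{f})$.
   Context: A duplicative tree is a planar rooted tree each of whose nodes is colored white or black. A duplicative forest is a finite word (sequence) of duplicative trees; $\epsilon$ is the empty forest and $\mathcal{D}^*$ the set of duplicative forests. For a forest $\mathfrak{f}$, $\circ(\mathfrak{f})$ (resp. $\bullet(\mathfrak{f})$) denotes the tree with a white (resp. black) root whose sequence of subtrees is $\mathfrak{f}$; concatenation of forests $\mathfrak{f},\mathfrak{f}'$ is written $\mathfrak{f}\mathfrak{f}'$. Write $\mathfrak{f} \Rightarrow_{\mathcal{D}} \mathfrak{f}'$ if $\mathfrak{f}'$ is obtained from $\mathfrak{f}$ by selecting a white node, whose subtree is $\circ(\mathfrak{g})$, and replacing that subtree by $\bullet(\mathfrak{g}\mathfrak{g})$ (turning the node black and duplicating its sequence of descendant subtrees). Let $\ll$ be the reflexive and transitive closure of $\Rightarrow_{\mathcal{D}}$ (a partial order), and $\mathcal{D}^*(\mathfrak{f})$ the subposet on $\{\mathfrak{f}' : \mathfrak{f}\ll\mathfrak{f}'\}$. The partial binary operations $\wedge$ and $\vee$ on $\mathcal{D}^*$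 are the commutative operations defined recursively by: for trees $\mathfrak{f}_1,\dots,\mathfrak{f}_\ell,\mathfrak{f}_1',\dots,\mathfrak{f}_\ell'$ ($\ell\ge 0$), $\mathfrak{f}_1\cdots\mathfrak{f}_\ell \wedge \mathfrak{f}_1'\cdots\mathfrak{f}_\ell' = (\mathfrak{f}_1\wedge\mathfrak{f}_1')\cdots(\mathfrak{f}_\ell\wedge\mathfrak{f}_\ell')$; for forests $\mathfrak{f},\mathfrak{f}'$ and each color, $\circ(\mathfrak{f})\wedge\circ(\mathfrak{f}') = \circ(\mathfrak{f}\wedge\mathfrak{f}')$ and $\bullet(\mathfrak{f})\wedge\bullet(\mathfrak{f}') = \bullet(\mathfrak{f}\wedge\mathfrak{f}')$; and $\circ(\mathfrak{f})\wedge\bullet(\mathfrak{f}'\mathfrak{f}'') = \circ(\mathfrak{f}\wedge\mathfrak{f}'\wedge\mathfrak{f}'')$ where $\mathfrak{f}',\mathfrak{f}''$ have the same number of trees as $\mathfrak{f}$. Similarly, $\mathfrak{f}_1\cdots\mathfrak{f}_\ell \vee \mathfrak{f}_1'\cdots\mathfrak{f}_\ell' = (\mathfrak{f}_1\vee\mathfrak{f}_1')\cdots(\mathfrak{f}_\ell\vee\mathfrak{f}_\ell')$, $\circ(\mathfrak{f})\vee\circ(\mathfrak{f}') = \circ(\mathfrak{f}\vee\mathfrak{f}')$, $\bullet(\mathfrak{f})\vee\bullet(\mathfrak{f}') = \bullet(\mathfrak{f}\vee\mathfrak{f}')$, and $\circ(\mathfrak{f})\vee\bullet(\mathfrak{f}'\mathfrak{f}'')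 = \bullet((\mathfrak{f}\vee\mathfrak{f}')(\mathfrak{f}\vee\mathfrak{f}''))$. -}

module Defs where

open import Data.List using (List; []; _∷_; _++_; length)
open import Data.Product using (Σ; ∃; _×_; _,_)
open import Relation.Binary.PropositionalEquality using (_≡_)
open import Relation.Binary.Construct.Closure.ReflexiveTransitive using (Star)

data Color : Set where
  white black : Color

data Tree : Set where
  node : Color → List Tree → Tree

Forest : Set
Forest = List Tree

∘ : Forest → Tree
∘ f = node white f

● : Forest → Tree
● f = node black f

mutual
  data StepT : Tree → Tree → Set where
    dup    : ∀ g → StepT (∘ g) (● (g ++ g))
    inside : ∀ {c g g'} → StepF g g' → StepT (node c g) (node c g')

  data StepF : Forest → Forest → Set where
    here  : ∀ {t t' f} → StepT t t' → StepF (t ∷ f) (t' ∷ f)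
    there : ∀ {t f f'} → StepF f f' → StepF (t ∷ f) (t ∷ f')

_≪_ : Forest → Forest → Set
_≪_ = Star StepF

-- Graph of the partial operation ∧ :  MeetF f f' r  means  f ∧ f' is defined and equals r.
-- f ∧ f' ∧ f'' is read as (f ∧ f') ∧ f''.
mutual
  data MeetT : Tree → Tree → Tree → Set where
    same   : ∀ {c f f' r} → MeetF f f' r → MeetT (node c f) (node c f') (node c r)
    wb     : ∀ {f f' f'' r s} → length f' ≡ length f → length f'' ≡ length f →
             MeetF f f' r → MeetF r f'' s → MeetT (∘ f) (● (f' ++ f'')) (∘ s)
    bw     : ∀ {f f' f'' r s} → length f' ≡ length f → length f'' ≡ length f →
             MeetF f f' r → MeetF r f'' s → MeetT (● (f' ++ f'')) (∘ f) (∘ s)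

  data MeetF : Forest → Forest → Forest → Set where
    []  : MeetF [] [] []
    _∷_ : ∀ {t t' u f f' v} → MeetT t t' u → MeetF f f' v → MeetF (t ∷ f) (t' ∷ f') (u ∷ v)

-- Graph of the partial operation ∨ :  JoinF f f' r  means  f ∨ f' is defined and equals r.
mutual
  data JoinT : Tree → Tree → Tree → Set where
    same   : ∀ {c f f' r} → JoinF f f' r → JoinT (node c f) (node c f') (node c r)
    wb     : ∀ {f f' f'' a b} → length f' ≡ length f → length f'' ≡ length f →
             JoinF f f' a → JoinF f f'' b → JoinT (∘ f) (● (f' ++ f'')) (● (a ++ b))
    bw     : ∀ {f f' f'' a b} → length f' ≡ length f → length f'' ≡ length f →
             JoinF f f' a → JoinF f f'' b → JoinT (● (f' ++ f'')) (∘ f) (● (a ++ b))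

  data JoinF : Forest → Forest → Forest → Set where
    []  : JoinF [] [] []
    _∷_ : ∀ {t t' u f f' v} → JoinT t t' u → JoinF f f' v → JoinF (t ∷ f) (t' ∷ f') (u ∷ v)

IsMeetIn : Forest → Forest → Forest → Forest → Set
IsMeetIn f g h m =
  (f ≪ m) × (m ≪ g) × (m ≪ h) × (∀ x → f ≪ x → x ≪ g → x ≪ h → x ≪ m)

IsJoinIn : Forest → Forest → Forest → Forest → Set
IsJoinIn f g h m =
  (f ≪ m) × (g ≪ m) × (h ≪ m) × (∀ x → f ≪ x → g ≪ x → h ≪ x → m ≪ x)

-- A white node ∘(a) lies below a tree exactly when that tree is ∘(b) with
-- a ≼ b, or ●(b) with a a ≼ b; together with "same colour, pointwise below"
-- this gives an inductive order ≼ on trees and forests which coincides with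
-- ≪. Since ≼ is compositional, the lattice properties of ∧ and ∨ follow by
-- mutual induction on their defining clauses, and both operations are
-- defined on any two forests above a common f by induction on f.

module Submission where

open import Defs
open import Data.List using ([]; _∷_; _++_; length)
open import Data.Nat using (suc)
open import Data.Nat.Properties using (suc-injective)
open import Data.Product using (∃; _×_; _,_; proj₁; proj₂; map₂; swap)
open import Relation.Binary.PropositionalEquality using (_≡_; refl; sym; trans; cong)
open import Relation.Binary.Construct.Closure.ReflexiveTransitive using (Star; ε; _◅_; _◅◅_; gmap)

infix 4 _≼ᵗ_ _≼_

mutual
  data _≼ᵗ_ : Tree → Tree → Set where
    ≼-node : ∀ {c a b} → a ≼ b → node c a ≼ᵗ node c b
    ≼-dup  : ∀ {a b} → a ++ a ≼ b → ∘ a ≼ᵗ ● b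

  data _≼_ : Forest → Forest → Set where
    []  : [] ≼ []
    _∷_ : ∀ {t u f g} → t ≼ᵗ u → f ≼ g → t ∷ f ≼ u ∷ g

mutual
  ≼ᵗ-refl : ∀ t → t ≼ᵗ t
  ≼ᵗ-refl (node c a) = ≼-node (≼-refl a)

  ≼-refl : ∀ f → f ≼ f
  ≼-refl []      = []
  ≼-refl (t ∷ f) = ≼ᵗ-refl t ∷ ≼-refl f

≼-++ : ∀ {a b c d} → a ≼ b → c ≼ d → a ++ c ≼ b ++ d
≼-++ []       q = q
≼-++ (p ∷ ps) q = p ∷ ≼-++ ps q

≼-length : ∀ {a b} → a ≼ b → length a ≡ length b
≼-length []       = refl
≼-length (_ ∷ ps) = cong suc (≼-length ps)

mutual
  ≼ᵗ-step : ∀ {x y z} → x ≼ᵗ y → StepT y z → x ≼ᵗ z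
  ≼ᵗ-step (≼-node p) (dup _)    = ≼-dup (≼-++ p p)
  ≼ᵗ-step (≼-node p) (inside s) = ≼-node (≼-step p s)
  ≼ᵗ-step (≼-dup p)  (inside s) = ≼-dup (≼-step p s)

  ≼-step : ∀ {x y z} → x ≼ y → StepF y z → x ≼ z
  ≼-step (p ∷ ps) (here s)  = ≼ᵗ-step p s ∷ ps
  ≼-step (p ∷ ps) (there s) = p ∷ ≼-step ps s

≪⇒≼ : ∀ {x y} → x ≪ y → x ≼ y
≪⇒≼ {x} = go (≼-refl x)
  where
  go : ∀ {y z} → x ≼ y → y ≪ z → x ≼ z
  go p ε        = p
  go p (s ◅ ss) = go (≼-step p s) ss

mutual
  ≼ᵗ⇒≪ᵗ : ∀ {x y} → x ≼ᵗ y → Star StepT x y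
  ≼ᵗ⇒≪ᵗ (≼-node {c} p) = gmap (node c) inside (≼⇒≪ p)
  ≼ᵗ⇒≪ᵗ (≼-dup {a} p)  = dup a ◅ gmap ● inside (≼⇒≪ p)

  ≼⇒≪ : ∀ {x y} → x ≼ y → x ≪ y
  ≼⇒≪ []                        = ε
  ≼⇒≪ (_∷_ {u = u} {f = f} p ps) =
    gmap (_∷ f) here (≼ᵗ⇒≪ᵗ p) ◅◅ gmap (u ∷_) there (≼⇒≪ ps)

≼-trans : ∀ {x y z} → x ≼ y → y ≼ z → x ≼ z
≼-trans p q = ≪⇒≼ (≼⇒≪ p ◅◅ ≼⇒≪ q)

data ++-Above (a₁ a₂ : Forest) : Forest → Set where
  split : ∀ {b₁ b₂} → a₁ ≼ b₁ → a₂ ≼ b₂ → ++-Above a₁ a₂ (b₁ ++ b₂)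

≼-++ˡ⁻ : ∀ a₁ {a₂ b} → a₁ ++ a₂ ≼ b → ++-Above a₁ a₂ b
≼-++ˡ⁻ []       p = split [] p
≼-++ˡ⁻ (_ ∷ a₁) (p ∷ ps) with ≼-++ˡ⁻ a₁ ps
... | split q r = split (p ∷ q) r

≼-++⁻ : ∀ {a₁ a₂ b₁ b₂} → length a₁ ≡ length b₁ → a₁ ++ a₂ ≼ b₁ ++ b₂ → a₁ ≼ b₁ × a₂ ≼ b₂
≼-++⁻ {[]}     {b₁ = []}     _ p        = [] , p
≼-++⁻ {_ ∷ a₁} {b₁ = _ ∷ b₁} e (p ∷ ps) with ≼-++⁻ {a₁} {b₁ = b₁} (suc-injective e) ps
... | q , r = p ∷ q , r

MeetF-++ : ∀ {a b c a' b' c'} → MeetF a b c → MeetF a' b' c' → MeetF (a ++ a') (b ++ b') (c ++ c')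
MeetF-++ []       q = q
MeetF-++ (p ∷ ps) q = p ∷ MeetF-++ ps q

JoinF-++ : ∀ {a b c a' b' c'} → JoinF a b c → JoinF a' b' c' → JoinF (a ++ a') (b ++ b') (c ++ c')
JoinF-++ []       q = q
JoinF-++ (p ∷ ps) q = p ∷ JoinF-++ ps q

JoinF-length : ∀ {g h j} → JoinF g h j → length g ≡ length h
JoinF-length []       = refl
JoinF-length (_ ∷ ps) = cong suc (JoinF-length ps)

mutual
  MeetT-comm : ∀ {g h m} → MeetT g h m → MeetT h g m
  MeetT-comm (same p)       = same (MeetF-comm p)
  MeetT-comm (wb e₁ e₂ p q) = bw e₁ e₂ p q
  MeetT-comm (bw e₁ e₂ p q) = wb e₁ e₂ p q

  MeetF-comm : ∀ {g h m} → MeetF g h m → MeetF h g m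
  MeetF-comm []       = []
  MeetF-comm (p ∷ ps) = MeetT-comm p ∷ MeetF-comm ps

mutual
  JoinT-comm : ∀ {g h j} → JoinT g h j → JoinT h g j
  JoinT-comm (same p)       = same (JoinF-comm p)
  JoinT-comm (wb e₁ e₂ p q) = bw e₁ e₂ p q
  JoinT-comm (bw e₁ e₂ p q) = wb e₁ e₂ p q

  JoinF-comm : ∀ {g h j} → JoinF g h j → JoinF h g j
  JoinF-comm []       = []
  JoinF-comm (p ∷ ps) = JoinT-comm p ∷ JoinF-comm ps

mutual
  MeetT-lower : ∀ {g h m} → MeetT g h m → m ≼ᵗ g × m ≼ᵗ h
  MeetT-lower (same p) with MeetF-lower p
  ... | m≼g , m≼h = ≼-node m≼g , ≼-node m≼h
  MeetT-lower (wb _ _ p q) = MeetT-lower-∘● p q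
  MeetT-lower (bw _ _ p q) = swap (MeetT-lower-∘● p q)

  MeetT-lower-∘● : ∀ {f f' f'' r s} → MeetF f f' r → MeetF r f'' s →
                   ∘ s ≼ᵗ ∘ f × ∘ s ≼ᵗ ● (f' ++ f'')
  MeetT-lower-∘● p q with MeetF-lower p | MeetF-lower q
  ... | r≼f , r≼f' | s≼r , s≼f'' =
    ≼-node (≼-trans s≼r r≼f) , ≼-dup (≼-++ (≼-trans s≼r r≼f') s≼f'')

  MeetF-lower : ∀ {g h m} → MeetF g h m → m ≼ g × m ≼ h
  MeetF-lower []       = [] , []
  MeetF-lower (p ∷ ps) with MeetT-lower p | MeetF-lower ps
  ... | a , b | c , d = a ∷ c , b ∷ d

mutual
  MeetT-greatest : ∀ {g h m x} → MeetT g h m → x ≼ᵗ g → x ≼ᵗ h → x ≼ᵗ m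
  MeetT-greatest (same p)         (≼-node a) (≼-node b) = ≼-node (MeetF-greatest p a b)
  MeetT-greatest (same p)         (≼-dup a)  (≼-dup b)  = ≼-dup (MeetF-greatest p a b)
  MeetT-greatest (wb e₁ _ p q)    (≼-node a) (≼-dup b)  = MeetT-greatest-∘● e₁ p q a b
  MeetT-greatest (bw e₁ _ p q)    (≼-dup b)  (≼-node a) = MeetT-greatest-∘● e₁ p q a b

  MeetT-greatest-∘● : ∀ {f f' f'' r s x} → length f' ≡ length f →
                      MeetF f f' r → MeetF r f'' s → x ≼ f → x ++ x ≼ f' ++ f'' → ∘ x ≼ᵗ ∘ s
  MeetT-greatest-∘● e p q a b with ≼-++⁻ (trans (≼-length a) (sym e)) b
  ... | b₁ , b₂ = ≼-node (MeetF-greatest q (MeetF-greatest p a b₁) b₂)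

  MeetF-greatest : ∀ {g h m x} → MeetF g h m → x ≼ g → x ≼ h → x ≼ m
  MeetF-greatest []       []       []       = []
  MeetF-greatest (p ∷ ps) (a ∷ as) (b ∷ bs) = MeetT-greatest p a b ∷ MeetF-greatest ps as bs

mutual
  MeetT-exists : ∀ t {g h} → t ≼ᵗ g → t ≼ᵗ h → ∃ λ m → MeetT g h m
  MeetT-exists (node c a) (≼-node p) (≼-node q) with MeetF-exists a p q
  ... | m , d = node c m , same d
  MeetT-exists (node _ a) (≼-node p) (≼-dup q) = MeetT-exists-∘● a p q
  MeetT-exists (node _ a) (≼-dup q) (≼-node p) = map₂ MeetT-comm (MeetT-exists-∘● a p q)
  MeetT-exists (node _ a) (≼-dup p) (≼-dup q) with ≼-++ˡ⁻ a p | ≼-++ˡ⁻ a q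
  ... | split p₁ p₂ | split q₁ q₂ with MeetF-exists a p₁ q₁ | MeetF-exists a p₂ q₂
  ... | m₁ , d₁ | m₂ , d₂ = ● (m₁ ++ m₂) , same (MeetF-++ d₁ d₂)

  -- The second meet exists because a lies below the first one as well.
  MeetT-exists-∘● : ∀ a {g h} → a ≼ g → a ++ a ≼ h → ∃ λ m → MeetT (∘ g) (● h) m
  MeetT-exists-∘● a p q with ≼-++ˡ⁻ a q
  ... | split q₁ q₂ with MeetF-exists a p q₁
  ... | r , d with MeetF-exists a (MeetF-greatest d p q₁) q₂
  ... | s , d' = ∘ s , wb (trans (sym (≼-length q₁)) (≼-length p))
                          (trans (sym (≼-length q₂)) (≼-length p)) d d'

  MeetF-exists : ∀ f {g h} → f ≼ g → f ≼ h → ∃ λ m → MeetF g h m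
  MeetF-exists []      []       []       = [] , []
  MeetF-exists (t ∷ f) (p ∷ ps) (q ∷ qs) with MeetT-exists t p q | MeetF-exists f ps qs
  ... | m , d | ms , ds = m ∷ ms , d ∷ ds

mutual
  JoinT-upper : ∀ {g h j} → JoinT g h j → g ≼ᵗ j × h ≼ᵗ j
  JoinT-upper (same p) with JoinF-upper p
  ... | g≼j , h≼j = ≼-node g≼j , ≼-node h≼j
  JoinT-upper (wb _ _ p q) = JoinT-upper-∘● p q
  JoinT-upper (bw _ _ p q) = swap (JoinT-upper-∘● p q)

  JoinT-upper-∘● : ∀ {f f' f'' a b} → JoinF f f' a → JoinF f f'' b →
                   ∘ f ≼ᵗ ● (a ++ b) × ● (f' ++ f'') ≼ᵗ ● (a ++ b)
  JoinT-upper-∘● p q with JoinF-upper p | JoinF-upper q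
  ... | f≼a , f'≼a | f≼b , f''≼b = ≼-dup (≼-++ f≼a f≼b) , ≼-node (≼-++ f'≼a f''≼b)

  JoinF-upper : ∀ {g h j} → JoinF g h j → g ≼ j × h ≼ j
  JoinF-upper []       = [] , []
  JoinF-upper (p ∷ ps) with JoinT-upper p | JoinF-upper ps
  ... | a , b | c , d = a ∷ c , b ∷ d

mutual
  JoinT-least : ∀ {g h j x} → JoinT g h j → g ≼ᵗ x → h ≼ᵗ x → j ≼ᵗ x
  JoinT-least (same p) (≼-node a) (≼-node b) = ≼-node (JoinF-least p a b)
  JoinT-least (same {f = f} p) (≼-dup a) (≼-dup b) with ≼-++ˡ⁻ f a
  ... | split a₁ a₂ with ≼-++⁻ (trans (sym (JoinF-length p)) (≼-length a₁)) b
  ... | b₁ , b₂ = ≼-dup (≼-++ (JoinF-least p a₁ b₁) (JoinF-least p a₂ b₂))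
  JoinT-least (wb e₁ _ p q) (≼-dup a)  (≼-node b) = JoinT-least-∘● e₁ p q a b
  JoinT-least (bw e₁ _ p q) (≼-node b) (≼-dup a)  = JoinT-least-∘● e₁ p q a b

  JoinT-least-∘● : ∀ {f f' f'' a b x} → length f' ≡ length f →
                   JoinF f f' a → JoinF f f'' b → f ++ f ≼ x → f' ++ f'' ≼ x → ● (a ++ b) ≼ᵗ ● x
  JoinT-least-∘● {f' = f'} e p q a b with ≼-++ˡ⁻ f' b
  ... | split b₁ b₂ with ≼-++⁻ (trans (sym e) (≼-length b₁)) a
  ... | a₁ , a₂ = ≼-node (≼-++ (JoinF-least p a₁ b₁) (JoinF-least q a₂ b₂))

  JoinF-least : ∀ {g h j x} → JoinF g h j → g ≼ x → h ≼ x → j ≼ x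
  JoinF-least []       []       []       = []
  JoinF-least (p ∷ ps) (a ∷ as) (b ∷ bs) = JoinT-least p a b ∷ JoinF-least ps as bs

mutual
  JoinT-exists : ∀ t {g h} → t ≼ᵗ g → t ≼ᵗ h → ∃ λ j → JoinT g h j
  JoinT-exists (node c a) (≼-node p) (≼-node q) with JoinF-exists a p q
  ... | j , d = node c j , same d
  JoinT-exists (node _ a) (≼-node p) (≼-dup q) = JoinT-exists-∘● a p q
  JoinT-exists (node _ a) (≼-dup q) (≼-node p) = map₂ JoinT-comm (JoinT-exists-∘● a p q)
  JoinT-exists (node _ a) (≼-dup p) (≼-dup q) with ≼-++ˡ⁻ a p | ≼-++ˡ⁻ a q
  ... | split p₁ p₂ | split q₁ q₂ with JoinF-exists a p₁ q₁ | JoinF-exists a p₂ q₂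
  ... | j₁ , d₁ | j₂ , d₂ = ● (j₁ ++ j₂) , same (JoinF-++ d₁ d₂)

  JoinT-exists-∘● : ∀ a {g h} → a ≼ g → a ++ a ≼ h → ∃ λ j → JoinT (∘ g) (● h) j
  JoinT-exists-∘● a p q with ≼-++ˡ⁻ a q
  ... | split q₁ q₂ with JoinF-exists a p q₁ | JoinF-exists a p q₂
  ... | j₁ , d₁ | j₂ , d₂ = ● (j₁ ++ j₂) , wb (trans (sym (≼-length q₁)) (≼-length p))
                                               (trans (sym (≼-length q₂)) (≼-length p)) d₁ d₂

  JoinF-exists : ∀ f {g h} → f ≼ g → f ≼ h → ∃ λ j → JoinF g h j
  JoinF-exists []      []       []       = [] , []
  JoinF-exists (t ∷ f) (p ∷ ps) (q ∷ qs) with JoinT-exists t p q | JoinF-exists f ps qs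
  ... | j , d | js , ds = j ∷ js , d ∷ ds

MeetF-isMeetIn : ∀ {f g h m} → f ≪ g → f ≪ h → MeetF g h m → IsMeetIn f g h m
MeetF-isMeetIn {g = g} {h} {m} f≪g f≪h d =
  greatest f≪g f≪h , ≼⇒≪ (proj₁ (MeetF-lower d)) , ≼⇒≪ (proj₂ (MeetF-lower d)) ,
  λ _ _ → greatest
  where
  greatest : ∀ {x} → x ≪ g → x ≪ h → x ≪ m
  greatest x≪g x≪h = ≼⇒≪ (MeetF-greatest d (≪⇒≼ x≪g) (≪⇒≼ x≪h))

JoinF-isJoinIn : ∀ {f g h j} → f ≪ g → JoinF g h j → IsJoinIn f g h j
JoinF-isJoinIn f≪g d =
  f≪g ◅◅ ≼⇒≪ (proj₁ (JoinF-upper d)) , ≼⇒≪ (proj₁ (JoinF-upper d)) , ≼⇒≪ (proj₂ (JoinF-upper d)) ,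
  λ _ _ g≪x h≪x → ≼⇒≪ (JoinF-least d (≪⇒≼ g≪x) (≪⇒≼ h≪x))

proposition2p3 : ∀ (f g h : Forest) → f ≪ g → f ≪ h →
    ((∃ λ m → MeetF g h m) × (∀ m → MeetF g h m → IsMeetIn f g h m)) ×
    ((∃ λ j → JoinF g h j) × (∀ j → JoinF g h j → IsJoinIn f g h j))
proposition2p3 f g h f≪g f≪h =
  (MeetF-exists f (≪⇒≼ f≪g) (≪⇒≼ f≪h) , λ _ → MeetF-isMeetIn f≪g f≪h) ,
  (JoinF-exists f (≪⇒≼ f≪g) (≪⇒≼ f≪h) , λ _ → JoinF-isJoinIn f≪g)
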